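{- Let $\mathbb{K}=(G,M,I)$ be a finite reduced formal context and let \[BC(\mathbb{K})=\Big(G\cup\overline{\mathcal{M}(M)},\ M,\ I\cup\{(\overline{m},n)\in\overline{\mathcal{M}(M)}\times M\mid m\not\geq_{\mathbb{K}} n\}\Big).\] Then $BC(\mathcal{CDB}(\mathbb{K}))=\mathcal{CDB}(BC(\mathbb{K}))$, where $BC(\mathcal{CDB}(\mathbb{K}))=\{A\to A^{\bullet}\mid A\to A^{\bullet}\in\mathcal{CDB}(\mathbb{K})\text{ and }|A|=1\}$.
   Context: For a formal context $(G,M,I)$, derivation operators are $A'=\{m\in M\mid\forall g\in A:(g,m)\in I\}$ for $A\subseteq G$ and $B'=\{g\in G\mid\forall m\in B:(g,m)\in I\}$ for $B\subseteq M$; concepts are pairs $(A,B)$ with $A'=B$, $B'=A$, ordered by inclusion of extents, forming the concept lattice; the attribute concept of $m$ is $(m',m'')$. An object $g$ is irreducible if there is no $X\subseteq G$ with $g\notin X$ and $X'=\{g\}'$; an attribute $m$ is irreducible if there is no $X\subseteq M$ with $m\notin X$ and $X'=\{m\}'$; the context is reduced if all objects and attributes are irreducible. For $m,n\in M$, $m\geq_{\mathbb{K}} n$ means $\{m\}'\supseteq\{n\}'$. $\mathcal{M}(M)$ is the set of attributes $m$ whose attribute concept is meet-irreducible in the concept lattice of $\mathbb{K}$, and $\overline{\mathcal{M}(M)}=\{\overline{m}\mid m\in\mathcal{M}(M)\}$ is a set of new objects disjoint from $G$. In a context, for $A\subseteq M$, $A^{\bullet}=A''\setminus\big(A\cup\bigcup_{n\in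 A}(A\setminus\{n\})''\big)$, and $A$ is a proper premise if $A^{\bullet}\neq\emptyset$. The canonical direct basis $\mathcal{CDB}$ of a context is the set of all implications $A\to A^{\bullet}$ where $A$ is a proper premise of that context (with $A^{\bullet}$ computed in that context). -}

module Defs where

open import Data.Nat using (ℕ)
open import Data.Bool using (Bool; T)
open import Data.Fin using (Fin)
open import Data.Fin.Subset using (Subset; _∈_; _∉_; _⊆_; _-_)
open import Data.Product using (Σ; ∃; _×_; _,_)
open import Data.Sum using (_⊎_; inj₁; inj₂)
open import Relation.Nullary using (¬_)
open import Function.Bundles using (_⇔_)

-- Only derivations of attribute sets are needed for the canonical direct basis.

module _ {Obj : Set} {n : ℕ} (I : Obj → Fin n → Set) where

  InClosure : Subset n → Fin n → Set
  InClosure A m = ∀ (g : Obj) → (∀ a → a ∈ A → I g a) → I g m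

  InBullet : Subset n → Fin n → Set
  InBullet A m = InClosure A m × m ∉ A × (∀ x → x ∈ A → ¬ InClosure (A - x) m)

  ProperPremise : Subset n → Set
  ProperPremise A = ∃ λ m → InBullet A m

  InCDB : Subset n → Subset n → Set
  InCDB A B = ProperPremise A × (∀ m → (m ∈ B) ⇔ InBullet A m)

module _ {nG nM : ℕ} (I : Fin nG → Fin nM → Bool) where

  Inc : Fin nG → Fin nM → Set
  Inc g m = T (I g m)

  ObjDerivP : Subset nG → Fin nM → Set
  ObjDerivP X m = ∀ g → g ∈ X → Inc g m

  AttrDerivP : Subset nM → Fin nG → Set
  AttrDerivP B g = ∀ m → m ∈ B → Inc g m

  ObjIrreducible : Fin nG → Set
  ObjIrreducible g =
    ¬ (Σ (Subset nG) λ X → g ∉ X × (∀ m → ObjDerivP X m ⇔ Inc g m))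

  AttrIrreducible : Fin nM → Set
  AttrIrreducible m =
    ¬ (Σ (Subset nM) λ X → m ∉ X × (∀ g → AttrDerivP X g ⇔ Inc g m))

  Reduced : Set
  Reduced = (∀ g → ObjIrreducible g) × (∀ m → AttrIrreducible m)

  record Concept : Set where
    field
      extent  : Subset nG
      intent  : Subset nM
      ext′≡int : ∀ m → (m ∈ intent) ⇔ ObjDerivP extent m
      int′≡ext : ∀ g → (g ∈ extent) ⇔ AttrDerivP intent g
  open Concept public

  _≤C_ : Concept → Concept → Set
  x ≤C y = extent x ⊆ extent y

  IsMeet : Concept → Concept → Concept → Set
  IsMeet x y z = x ≤C y × x ≤C z × (∀ w → w ≤C y → w ≤C z → w ≤C x)

  -- meet-irreducible: x is not the top element, and whenever x = y ∧ z,
  -- then x = y or x = z (given x ≤ y, x = y amounts to y ≤ x)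
  MeetIrreducible : Concept → Set
  MeetIrreducible x =
    ¬ (∀ w → w ≤C x) ×
    (∀ y z → IsMeet x y z → (y ≤C x) ⊎ (z ≤C x))

  IsAttrConcept : Fin nM → Concept → Set
  IsAttrConcept m x = ∀ g → (g ∈ extent x) ⇔ Inc g m

  InMeetIrr : Fin nM → Set
  InMeetIrr m = Σ Concept λ x → IsAttrConcept m x × MeetIrreducible x

  _≥K_ : Fin nM → Fin nM → Set
  m ≥K n = ∀ g → Inc g n → Inc g m

  BCObj : Set
  BCObj = Fin nG ⊎ Σ (Fin nM) InMeetIrr

  BCInc : BCObj → Fin nM → Set
  BCInc (inj₁ g) n = Inc g n
  BCInc (inj₂ (m , _)) n = ¬ (m ≥K n)

{-# OPTIONS --safe #-}
-- In BC(K) every attribute n owns an object n̄ (its attribute concept is meet-irreducible since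
-- n is irreducible) whose attributes are exactly the a with a' ⊈ n'.  Hence n ∈ A'' in BC(K)
-- iff a' ⊆ n' for some a ∈ A.  So ∅'' = ∅ and {a}'' = {n | a' ⊆ n'} in BC(K), as in K (where
-- ∅'' = ∅ again by irreducibility of n), and a singleton has the same bullet in both contexts.
-- Moreover, if n ∈ A• in BC(K), the a ∈ A with a' ⊆ n' puts n into (A ∖ {x})'' for every
-- x ≠ a in A, so A = {a}: the proper premises of BC(K) are singletons.
module Submission where

open import Defs
open import Data.Nat using (ℕ)
open import Data.Nat.Properties using (suc-injective)
open import Data.Bool using (Bool; T)
open import Data.Bool.Properties using (T-≡)
open import Data.Fin using (Fin; zero; suc; _≟_)
open import Data.Fin.Subset
  using (Subset; ∣_∣; _∈_; _∉_; _⊆_; _-_; _─_; ⁅_⁆; _∪_; ⊥; inside; outside)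
open import Data.Fin.Subset.Properties
  using (_∈?_; _⊆?_; ∉⊥; x∈⁅x⁆; x∈⁅y⁆⇒x≡y; ∣⁅x⁆∣≡1; ⊆-antisym; x∈p∪q⁻; x∈p∪q⁺; x∈p∧x≢y⇒x∈p-y)
open import Data.Fin.Properties using (all?; any?)
open import Data.Vec using ([]; _∷_; tabulate)
open import Data.Vec.Properties using ([]=⇒lookup; lookup⇒[]=; lookup∘tabulate)
open import Data.Product using (_×_; _,_; ∃; proj₁; proj₂; uncurry)
open import Data.Product.Function.NonDependent.Propositional using (_×-⇔_)
open import Data.Sum using (_⊎_; inj₁; inj₂; [_,_])
open import Relation.Nullary using (¬_; Dec; yes; no; contradiction)
open import Relation.Nullary.Decidable
  using (⌊_⌋; T?; _→-dec_; _×-dec_; toWitness; fromWitness; decidable-stable)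
open import Relation.Unary using (Pred; Decidable)
open import Relation.Binary.PropositionalEquality using (_≡_; refl; sym; trans; subst; cong)
open import Function using (_∘_; id)
open import Function.Bundles using (_⇔_; mk⇔; Equivalence)
open import Function.Construct.Composition using (_⇔-∘_)
open import Function.Construct.Identity using (⇔-id)
open import Function.Construct.Symmetry using (⇔-sym)

open Equivalence using (to; from)

subsetOf : ∀ {n p} {P : Pred (Fin n) p} → Decidable P → Subset n
subsetOf P? = tabulate (⌊_⌋ ∘ P?)

∈-subsetOf : ∀ {n p} {P : Pred (Fin n) p} (P? : Decidable P) {x} → x ∈ subsetOf P? ⇔ P x
∈-subsetOf P? {x} = mk⇔
  (λ x∈ → toWitness (from T-≡ (trans (sym (lookup∘tabulate _ x)) ([]=⇒lookup x∈))))
  (λ Px → lookup⇒[]= x _ (trans (lookup∘tabulate _ x) (to T-≡ (fromWitness Px))))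

∀∈⁅x⁆⇔Px : ∀ {n p} {P : Pred (Fin n) p} {x} → (∀ y → y ∈ ⁅ x ⁆ → P y) ⇔ P x
∀∈⁅x⁆⇔Px {P = P} {x} =
  mk⇔ (λ ∀P → ∀P x (x∈⁅x⁆ x)) (λ Px y y∈ → subst P (sym (x∈⁅y⁆⇒x≡y x y∈)) Px)

p─p≡⊥ : ∀ {n} (p : Subset n) → p ─ p ≡ ⊥
p─p≡⊥ []            = refl
p─p≡⊥ (outside ∷ p) = cong (outside ∷_) (p─p≡⊥ p)
p─p≡⊥ (inside  ∷ p) = cong (outside ∷_) (p─p≡⊥ p)

∣p∣≡0⇒p≡⊥ : ∀ {n} (p : Subset n) → ∣ p ∣ ≡ 0 → p ≡ ⊥
∣p∣≡0⇒p≡⊥ []            _      = refl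
∣p∣≡0⇒p≡⊥ (outside ∷ p) ∣p∣≡0 = cong (outside ∷_) (∣p∣≡0⇒p≡⊥ p ∣p∣≡0)
∣p∣≡0⇒p≡⊥ (inside  ∷ p) ()

∣p∣≡1⇒p≡⁅x⁆ : ∀ {n} (p : Subset n) → ∣ p ∣ ≡ 1 → ∃ λ x → p ≡ ⁅ x ⁆
∣p∣≡1⇒p≡⁅x⁆ (inside  ∷ p) ∣p∣≡1 =
  zero , cong (inside ∷_) (∣p∣≡0⇒p≡⊥ p (suc-injective ∣p∣≡1))
∣p∣≡1⇒p≡⁅x⁆ (outside ∷ p) ∣p∣≡1 with ∣p∣≡1⇒p≡⁅x⁆ p ∣p∣≡1
... | x , p≡⁅x⁆ = suc x , cong (outside ∷_) p≡⁅x⁆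

module _ {Obj : Set} {n : ℕ} (R : Obj → Fin n → Set) where

  closure-⁅⁆ : ∀ {a m} → InClosure R ⁅ a ⁆ m ⇔ (∀ g → R g a → R g m)
  closure-⁅⁆ = mk⇔ (λ c g ga → c g (from ∀∈⁅x⁆⇔Px ga)) (λ le g h → le g (to ∀∈⁅x⁆⇔Px h))

  bullet-⁅⁆ : (∀ m → ¬ InClosure R ⊥ m) →
              ∀ {a m} → InBullet R ⁅ a ⁆ m ⇔ (InClosure R ⁅ a ⁆ m × m ∉ ⁅ a ⁆)
  bullet-⁅⁆ ∅″≡∅ {a} {m} = mk⇔ (λ (c , m∉ , _) → c , m∉) (λ (c , m∉) → c , m∉ , minimal)
    where
    minimal : ∀ x → x ∈ ⁅ a ⁆ → ¬ InClosure R (⁅ a ⁆ - x) m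
    minimal x x∈ rewrite x∈⁅y⁆⇒x≡y a x∈ | p─p≡⊥ ⁅ a ⁆ = ∅″≡∅ m

InCDB-transfer : ∀ {O₁ O₂ n} {R : O₁ → Fin n → Set} {S : O₂ → Fin n → Set} {A B} →
                 (∀ m → InBullet R A m ⇔ InBullet S A m) → InCDB R A B → InCDB S A B
InCDB-transfer R⇔S ((m , m∈A•) , B≡A•) = (m , to (R⇔S m) m∈A•) , λ k → R⇔S k ⇔-∘ B≡A• k

InCDB-cong : ∀ {O₁ O₂ n} {R : O₁ → Fin n → Set} {S : O₂ → Fin n → Set} {A B} →
             (∀ m → InBullet R A m ⇔ InBullet S A m) → InCDB R A B ⇔ InCDB S A B
InCDB-cong R⇔S = mk⇔ (InCDB-transfer R⇔S) (InCDB-transfer (⇔-sym ∘ R⇔S))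

module _ {nG nM : ℕ} (I : Fin nG → Fin nM → Bool) where

  _≥_ : Fin nM → Fin nM → Set
  _≥_ = _≥K_ I

  _≥?_ : ∀ m n → Dec (m ≥ n)
  m ≥? n = all? λ g → T? (I g n) →-dec T? (I g m)

  attrDeriv? : ∀ B g → Dec (AttrDerivP I B g)
  attrDeriv? B g = all? λ k → k ∈? B →-dec T? (I g k)

  objDeriv? : ∀ X m → Dec (ObjDerivP I X m)
  objDeriv? X m = all? λ g → g ∈? X →-dec T? (I g m)

  conceptOf : Subset nM → Concept I
  conceptOf B = record
    { extent   = B′
    ; intent   = B″
    ; ext′≡int = λ _ → ∈-subsetOf (objDeriv? B′)
    ; int′≡ext = λ g → mk⇔ (λ g∈B′ k k∈B″ → to (∈-subsetOf (objDeriv? B′)) k∈B″ g g∈B′)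
                            (λ g∈B″′ → from (∈-subsetOf (attrDeriv? B)) (λ k → g∈B″′ k ∘ B⊆B″))
    }
    where
    B′ : Subset nG
    B′ = subsetOf (attrDeriv? B)
    B″ : Subset nM
    B″ = subsetOf (objDeriv? B′)
    B⊆B″ : B ⊆ B″
    B⊆B″ {k} k∈B = from (∈-subsetOf (objDeriv? B′))
                     (λ g g∈B′ → to (∈-subsetOf (attrDeriv? B)) g∈B′ k k∈B)

  ∈-extent-conceptOf : ∀ B {g} → g ∈ extent (conceptOf B) ⇔ AttrDerivP I B g
  ∈-extent-conceptOf B = ∈-subsetOf (attrDeriv? B)

  attrDeriv-∪-intent : ∀ y z {g} →
                       AttrDerivP I (intent y ∪ intent z) g ⇔ (g ∈ extent y × g ∈ extent z)
  attrDeriv-∪-intent y z {g} = mk⇔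
    (λ g′ → from (int′≡ext y g) (λ k → g′ k ∘ x∈p∪q⁺ ∘ inj₁) ,
            from (int′≡ext z g) (λ k → g′ k ∘ x∈p∪q⁺ ∘ inj₂))
    (λ (g∈y , g∈z) k → [ to (int′≡ext y g) g∈y k , to (int′≡ext z g) g∈z k ]
                         ∘ x∈p∪q⁻ (intent y) (intent z))

  ∈intent⇒≤attrConcept : ∀ {m x y} → IsAttrConcept I m x → m ∈ intent y → _≤C_ I y x
  ∈intent⇒≤attrConcept {m} {y = y} x-attr m∈y {g} g∈y =
    from (x-attr g) (to (int′≡ext y g) g∈y m m∈y)

  attrIrreducible⇒meetIrreducible : ∀ {m x} →
    AttrIrreducible I m → IsAttrConcept I m x → MeetIrreducible I x
  attrIrreducible⇒meetIrreducible {m} {x} m-irr x-attr = notTop , prime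
    where
    notTop : ¬ (∀ w → _≤C_ I w x)
    notTop ≤x = m-irr (⊥ , ∉⊥ , λ g → mk⇔ (λ _ → to (x-attr g) (≤x (conceptOf ⊥) g∈⊥′))
                                           (λ _ _ k∈⊥ → contradiction k∈⊥ ∉⊥))
      where
      g∈⊥′ : ∀ {g} → g ∈ extent (conceptOf ⊥)
      g∈⊥′ = from (∈-extent-conceptOf ⊥) (λ _ k∈⊥ → contradiction k∈⊥ ∉⊥)
    prime : ∀ y z → IsMeet I x y z → _≤C_ I y x ⊎ _≤C_ I z x
    prime y z (x≤y , x≤z , glb) with extent y ⊆? extent x | extent z ⊆? extent x
    ... | yes y≤x | _       = inj₁ y≤x
    ... | no _    | yes z≤x = inj₂ z≤x
    ... | no y≰x  | no z≰x  = contradiction (intent y ∪ intent z , m∉ , same-extent) m-irr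
      where
      m∉ : m ∉ intent y ∪ intent z
      m∉ = [ (λ m∈y → y≰x (∈intent⇒≤attrConcept {x = x} {y = y} x-attr m∈y))
           , (λ m∈z → z≰x (∈intent⇒≤attrConcept {x = x} {y = z} x-attr m∈z))
           ] ∘ x∈p∪q⁻ (intent y) (intent z)
      y∧z : Concept I
      y∧z = conceptOf (intent y ∪ intent z)
      y∧z≤x : _≤C_ I y∧z x
      y∧z≤x = glb y∧z (proj₁ ∘ to (attrDeriv-∪-intent y z) ∘ to (∈-extent-conceptOf _))
                      (proj₂ ∘ to (attrDeriv-∪-intent y z) ∘ to (∈-extent-conceptOf _))
      same-extent : ∀ g → AttrDerivP I (intent y ∪ intent z) g ⇔ Inc I g m
      same-extent g = mk⇔
        (λ g′ → to (x-attr g) (y∧z≤x (from (∈-extent-conceptOf _) g′)))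
        (λ gm → let g∈x = from (x-attr g) gm in from (attrDeriv-∪-intent y z) (x≤y g∈x , x≤z g∈x))

  attrIrreducible⇒inMeetIrr : ∀ {m} → AttrIrreducible I m → InMeetIrr I m
  attrIrreducible⇒inMeetIrr {m} m-irr =
    conceptOf ⁅ m ⁆ , m-attr , attrIrreducible⇒meetIrreducible {x = conceptOf ⁅ m ⁆} m-irr m-attr
    where
    m-attr : IsAttrConcept I m (conceptOf ⁅ m ⁆)
    m-attr g = ∀∈⁅x⁆⇔Px {P = Inc I g} ⇔-∘ ∈-extent-conceptOf ⁅ m ⁆

  attrIrreducible⇒∉∅″ : ∀ {n} → AttrIrreducible I n → ¬ InClosure (Inc I) ⊥ n
  attrIrreducible⇒∉∅″ n-irr n∈∅″ =
    n-irr (⊥ , ∉⊥ , λ g → mk⇔ (n∈∅″ g) (λ _ _ k∈⊥ → contradiction k∈⊥ ∉⊥))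

  closureBC⁺ : ∀ {A a n} → a ∈ A → n ≥ a → InClosure (BCInc I) A n
  closureBC⁺ {a = a} a∈A n≥a (inj₁ g)       g′ = n≥a g (g′ a a∈A)
  closureBC⁺ {a = a} a∈A n≥a (inj₂ (m , _)) m̄′ m≥n = m̄′ a a∈A (λ g → m≥n g ∘ n≥a g)

  closureBC⁻ : ∀ {A n} → InMeetIrr I n → InClosure (BCInc I) A n → ∃ λ a → a ∈ A × n ≥ a
  closureBC⁻ {A} {n} n-mi n∈A″ = decidable-stable (any? λ a → a ∈? A ×-dec n ≥? a)
    (λ ∄a → n∈A″ (inj₂ (n , n-mi)) (λ a a∈A n≥a → ∄a (a , a∈A , n≥a)) (λ _ → id))

  module _ (attrIrr : ∀ m → AttrIrreducible I m) where

    closureBC : ∀ {A n} → InClosure (BCInc I) A n ⇔ (∃ λ a → a ∈ A × n ≥ a)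
    closureBC = mk⇔ (closureBC⁻ (attrIrreducible⇒inMeetIrr (attrIrr _)))
                    (λ (_ , a∈A , n≥a) → closureBC⁺ a∈A n≥a)

    closureBC-⁅⁆ : ∀ {a n} → InClosure (BCInc I) ⁅ a ⁆ n ⇔ n ≥ a
    closureBC-⁅⁆ {a} {n} = mk⇔
      (λ n∈a″ → let b , b∈⁅a⁆ , n≥b = to closureBC n∈a″ in subst (n ≥_) (x∈⁅y⁆⇒x≡y a b∈⁅a⁆) n≥b)
      (λ n≥a → from closureBC (a , x∈⁅x⁆ a , n≥a))

    bullet-⁅⁆-K : ∀ {a n} → InBullet (Inc I) ⁅ a ⁆ n ⇔ (n ≥ a × n ∉ ⁅ a ⁆)
    bullet-⁅⁆-K =
      (closure-⁅⁆ (Inc I) ×-⇔ ⇔-id _) ⇔-∘ bullet-⁅⁆ (Inc I) (λ _ → attrIrreducible⇒∉∅″ (attrIrr _))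

    bullet-⁅⁆-BC : ∀ {a n} → InBullet (BCInc I) ⁅ a ⁆ n ⇔ (n ≥ a × n ∉ ⁅ a ⁆)
    bullet-⁅⁆-BC =
      (closureBC-⁅⁆ ×-⇔ ⇔-id _) ⇔-∘ bullet-⁅⁆ (BCInc I) (λ _ → ∉⊥ ∘ proj₁ ∘ proj₂ ∘ to closureBC)

    CDB-⁅⁆-K⇔BC : ∀ {a B} → InCDB (Inc I) ⁅ a ⁆ B ⇔ InCDB (BCInc I) ⁅ a ⁆ B
    CDB-⁅⁆-K⇔BC = InCDB-cong (λ _ → ⇔-sym bullet-⁅⁆-BC ⇔-∘ bullet-⁅⁆-K)

    properPremiseBC⇒singleton : ∀ {A} → ProperPremise (BCInc I) A → ∃ λ a → A ≡ ⁅ a ⁆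
    properPremiseBC⇒singleton {A} (n , n∈A″ , _ , minimal) with to closureBC n∈A″
    ... | a , a∈A , n≥a = a , ⊆-antisym A⊆⁅a⁆ (λ b∈⁅a⁆ → subst (_∈ A) (sym (x∈⁅y⁆⇒x≡y a b∈⁅a⁆)) a∈A)
      where
      A⊆⁅a⁆ : A ⊆ ⁅ a ⁆
      A⊆⁅a⁆ {x} x∈A with x ≟ a
      ... | yes refl = x∈⁅x⁆ x
      ... | no x≢a   =
        contradiction (closureBC⁺ (x∈p∧x≢y⇒x∈p-y a∈A (x≢a ∘ sym)) n≥a) (minimal x x∈A)

    singletonCDB⇒CDB-BC : ∀ {A B} → InCDB (Inc I) A B → ∣ A ∣ ≡ 1 → InCDB (BCInc I) A B
    singletonCDB⇒CDB-BC {A} cdb ∣A∣≡1 with ∣p∣≡1⇒p≡⁅x⁆ A ∣A∣≡1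
    ... | a , refl = to CDB-⁅⁆-K⇔BC cdb

    CDB-BC⇒singletonCDB : ∀ {A B} → InCDB (BCInc I) A B → InCDB (Inc I) A B × ∣ A ∣ ≡ 1
    CDB-BC⇒singletonCDB cdb with properPremiseBC⇒singleton (proj₁ cdb)
    ... | a , refl = from CDB-⁅⁆-K⇔BC cdb , ∣⁅x⁆∣≡1 a

corollary2 : (nG nM : ℕ) (I : Fin nG → Fin nM → Bool) → Reduced I →
    (A B : Subset nM) →
    (InCDB (Inc I) A B × ∣ A ∣ ≡ 1) ⇔ InCDB (BCInc I) A B
corollary2 nG nM I (_ , attrIrr) A B =
  mk⇔ (uncurry (singletonCDB⇒CDB-BC I attrIrr)) (CDB-BC⇒singletonCDB I attrIrr)
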